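{- If $(t_k)$ and $(\tau_k)$, $k=0,1,2,\ldots$, are a binomial-transform pair of the first kind, then so are the sequences \[ a_k=\frac{1}{k+1}\sum_{j=0}^k\frac{t_j}{j+1}\quad\text{and}\quad \alpha_k=\frac{1}{(k+1)^2}\sum_{j=0}^k\tau_j,\qquad k=0,1,2,\ldots. \]
   Context: Two sequences $(t_k)_{k\ge0}$ and $(\tau_k)_{k\ge0}$ of complex numbers form a binomial-transform pair of the first kind if $\tau_n=\sum_{k=0}^n(-1)^k\binom nk t_k$ for every non-negative integer $n$. -}

module Defs where

open import Level using (Level)
open import Data.Nat using (ℕ; zero; suc)
open import Data.Nat.Combinatorics using (_C_)
open import Algebra.Bundles using (CommutativeRing)

-- Everything is stated over an arbitrary commutative ring R in which every
-- positive integer k+1 is invertible (i.e. a ℚ-algebra; ℂ is an instance).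
module Binomial {c ℓ : Level} (R : CommutativeRing c ℓ) where
  open CommutativeRing R

  ι : ℕ → Carrier
  ι zero    = 0#
  ι (suc n) = 1# + ι n

  sgn : ℕ → Carrier
  sgn zero    = 1#
  sgn (suc k) = - (sgn k)

  Σ≤ : ℕ → (ℕ → Carrier) → Carrier
  Σ≤ zero    f = f 0
  Σ≤ (suc n) f = Σ≤ n f + f (suc n)

  BinomialPair : (ℕ → Carrier) → (ℕ → Carrier) → Set ℓ
  BinomialPair t τ = ∀ n → τ n ≈ Σ≤ n (λ k → sgn k * ι (n C k) * t k)

  InvertsPositives : (ℕ → Carrier) → Set ℓ
  InvertsPositives inv = ∀ k → ι (suc k) * inv k ≈ 1#

  aSeq : (ℕ → Carrier) → (ℕ → Carrier) → ℕ → Carrier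
  aSeq inv t k = inv k * Σ≤ k (λ j → t j * inv j)

  αSeq : (ℕ → Carrier) → (ℕ → Carrier) → ℕ → Carrier
  αSeq inv τ k = (inv k * inv k) * Σ≤ k τ

module Submission where

-- Write u k = Σ_{j≤k} t j/(j+1), so that a k = u k/(k+1). The absorption identity
-- C(n,k)/(k+1) = C(n+1,k+1)/(n+1) turns the transform of a into
-- (1/(n+1)) Σ_k (-1)^k C(n+1,k+1) u k. By Pascal's rule (-1)^k C(n+1,k+1) = d k - d (k+1)
-- with d k = (-1)^k C(n,k), so summation by parts (d (n+1) = 0) rewrites this as
-- (1/(n+1)) Σ_k (-1)^k C(n,k) t k/(k+1). Absorbing once more gives
-- (1/(n+1)^2) Σ_k (-1)^k C(n+1,k+1) t k, and by the hockey-stick identity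
-- Σ_{m≤n} C(m,k) = C(n+1,k+1) this is (1/(n+1)^2) Σ_{m≤n} τ m.

open import Defs
open import Level using (Level)
open import Data.Nat using (ℕ; zero; suc; _<_)
import Data.Nat as ℕ
import Data.Nat.Properties as ℕₚ
open import Data.Nat.Combinatorics using (_C_; nC1≡n; k>n⇒nCk≡0; nCk+nC[k+1]≡[n+1]C[k+1])
open import Data.Nat.Tactic.RingSolver using (solve-∀)
open import Algebra.Bundles using (CommutativeRing)
open import Relation.Binary.PropositionalEquality as ≡ using (_≡_)
import Relation.Binary.Reasoning.Setoid as SetoidReasoning

[k+1]*[n+1]C[k+1]≡[n+1]*nCk : ∀ n k → suc k ℕ.* (suc n C suc k) ≡ suc n ℕ.* (n C k)
[k+1]*[n+1]C[k+1]≡[n+1]*nCk n       zero    =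
  ≡.trans (ℕₚ.+-identityʳ _) (≡.trans (nC1≡n (suc n)) (≡.sym (ℕₚ.*-identityʳ (suc n))))
[k+1]*[n+1]C[k+1]≡[n+1]*nCk zero    (suc k) = ℕₚ.*-zeroʳ (suc (suc k))
[k+1]*[n+1]C[k+1]≡[n+1]*nCk (suc n) (suc k) = begin
  suc (suc k) ℕ.* (suc (suc n) C suc (suc k))
    ≡⟨ ≡.cong (suc (suc k) ℕ.*_) (nCk+nC[k+1]≡[n+1]C[k+1] (suc n) (suc k)) ⟨
  suc (suc k) ℕ.* (A ℕ.+ B)
    ≡⟨ regroup A B k ⟩
  A ℕ.+ (suc k ℕ.* A ℕ.+ suc (suc k) ℕ.* B)
    ≡⟨ ≡.cong (A ℕ.+_) (≡.cong₂ ℕ._+_ ([k+1]*[n+1]C[k+1]≡[n+1]*nCk n k)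
                                       ([k+1]*[n+1]C[k+1]≡[n+1]*nCk n (suc k))) ⟩
  A ℕ.+ (suc n ℕ.* (n C k) ℕ.+ suc n ℕ.* (n C suc k))
    ≡⟨ ≡.cong (A ℕ.+_) (ℕₚ.*-distribˡ-+ (suc n) (n C k) (n C suc k)) ⟨
  A ℕ.+ suc n ℕ.* (n C k ℕ.+ n C suc k)
    ≡⟨ ≡.cong (λ x → A ℕ.+ suc n ℕ.* x) (nCk+nC[k+1]≡[n+1]C[k+1] n k) ⟩
  suc (suc n) ℕ.* A ∎
  where
  open ≡.≡-Reasoning
  A B : ℕ
  A = suc n C suc k
  B = suc n C suc (suc k)
  regroup : ∀ a b k → (2 ℕ.+ k) ℕ.* (a ℕ.+ b) ≡ a ℕ.+ ((1 ℕ.+ k) ℕ.* a ℕ.+ (2 ℕ.+ k) ℕ.* b)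
  regroup = solve-∀

module BinomialTransform {c ℓ : Level} (R : CommutativeRing c ℓ) where
  open CommutativeRing R
  open Binomial R
  open SetoidReasoning setoid
  open import Algebra.Properties.CommutativeSemigroup +-commutativeSemigroup using (interchange)
  open import Algebra.Properties.Monoid.Mult +-monoid using (_×_; ×-homo-+)
  open import Algebra.Properties.Semiring.Mult semiring using (×1-homo-*)
  -- the solver's _⊕_ is the monoid operation, here _*_
  open import Algebra.Solver.CommutativeMonoid *-commutativeMonoid using (solve; _⊜_; _⊕_)

  Σ≤-cong : ∀ n {f g : ℕ → Carrier} → (∀ k → f k ≈ g k) → Σ≤ n f ≈ Σ≤ n g
  Σ≤-cong zero    f≈g = f≈g 0
  Σ≤-cong (suc n) f≈g = +-cong (Σ≤-cong n f≈g) (f≈g (suc n))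

  Σ≤-distrib-+ : ∀ n (f g : ℕ → Carrier) → Σ≤ n (λ k → f k + g k) ≈ Σ≤ n f + Σ≤ n g
  Σ≤-distrib-+ zero    f g = refl
  Σ≤-distrib-+ (suc n) f g = trans (+-congʳ (Σ≤-distrib-+ n f g)) (interchange _ _ _ _)

  *-distribˡ-Σ≤ : ∀ n x (f : ℕ → Carrier) → x * Σ≤ n f ≈ Σ≤ n (λ k → x * f k)
  *-distribˡ-Σ≤ zero    x f = refl
  *-distribˡ-Σ≤ (suc n) x f = trans (distribˡ x _ _) (+-congʳ (*-distribˡ-Σ≤ n x f))

  Σ≤-by-parts : ∀ {c d : ℕ → Carrier} → (∀ k → c k + d (suc k) ≈ d k) → ∀ s n →
    Σ≤ n (λ k → d k * s k) ≈ Σ≤ n (λ k → c k * Σ≤ k s) + d (suc n) * Σ≤ n s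
  Σ≤-by-parts {c} {d} Δ s zero = trans (*-congʳ (sym (Δ 0))) (distribʳ (s 0) (c 0) (d 1))
  Σ≤-by-parts {c} {d} Δ s (suc n) = begin
    Σ≤ n (λ k → d k * s k) + d₁ * X   ≈⟨ +-congʳ (Σ≤-by-parts Δ s n) ⟩
    (P + d₁ * U) + d₁ * X             ≈⟨ +-assoc P _ _ ⟩
    P + (d₁ * U + d₁ * X)             ≈⟨ +-congˡ (sym (distribˡ d₁ U X)) ⟩
    P + d₁ * (U + X)                  ≈⟨ +-congˡ (*-congʳ (sym (Δ (suc n)))) ⟩
    P + (c₁ + d₂) * (U + X)           ≈⟨ +-congˡ (distribʳ (U + X) c₁ d₂) ⟩
    P + (c₁ * (U + X) + d₂ * (U + X)) ≈⟨ +-assoc P _ _ ⟨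
    (P + c₁ * (U + X)) + d₂ * (U + X) ∎
    where
    P U X c₁ d₁ d₂ : Carrier
    P  = Σ≤ n (λ k → c k * Σ≤ k s)
    U  = Σ≤ n s
    X  = s (suc n)
    c₁ = c (suc n)
    d₁ = d (suc n)
    d₂ = d (suc (suc n))

  ι≡×1# : ∀ n → ι n ≡ n × 1#
  ι≡×1# zero    = ≡.refl
  ι≡×1# (suc n) = ≡.cong (1# +_) (ι≡×1# n)

  ι-+ : ∀ m n → ι (m ℕ.+ n) ≈ ι m + ι n
  ι-+ m n rewrite ι≡×1# m | ι≡×1# n | ι≡×1# (m ℕ.+ n) = ×-homo-+ 1# m n

  ι-* : ∀ m n → ι (m ℕ.* n) ≈ ι m * ι n
  ι-* m n rewrite ι≡×1# m | ι≡×1# n | ι≡×1# (m ℕ.* n) = ×1-homo-* m n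

  ι-pascal : ∀ n k → ι (suc n C suc k) ≈ ι (n C k) + ι (n C suc k)
  ι-pascal n k =
    trans (reflexive (≡.cong ι (≡.sym (nCk+nC[k+1]≡[n+1]C[k+1] n k)))) (ι-+ (n C k) (n C suc k))

  k>n⇒w*nCk*x≈0 : ∀ {n k} w x → n < k → w * ι (n C k) * x ≈ 0#
  k>n⇒w*nCk*x≈0 {n} {k} w x n<k = begin
    w * ι (n C k) * x ≈⟨ *-congʳ (*-congˡ (reflexive (≡.cong ι (k>n⇒nCk≡0 n<k)))) ⟩
    w * 0# * x        ≈⟨ *-congʳ (zeroʳ w) ⟩
    0# * x            ≈⟨ zeroˡ x ⟩
    0#                ∎

  sgn*C-pascal : ∀ n k → sgn k * ι (suc n C suc k) + sgn (suc k) * ι (n C suc k) ≈ sgn k * ι (n C k)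
  sgn*C-pascal n k = begin
    s * ι (suc n C suc k) + - s * b ≈⟨ +-congʳ (*-congˡ (ι-pascal n k)) ⟩
    s * (a + b) + - s * b           ≈⟨ +-congʳ (distribˡ s a b) ⟩
    (s * a + s * b) + - s * b       ≈⟨ +-assoc (s * a) _ _ ⟩
    s * a + (s * b + - s * b)       ≈⟨ +-congˡ (distribʳ b s (- s)) ⟨
    s * a + (s - s) * b             ≈⟨ +-congˡ (*-congʳ (-‿inverseʳ s)) ⟩
    s * a + 0# * b                  ≈⟨ +-congˡ (zeroˡ b) ⟩
    s * a + 0#                      ≈⟨ +-identityʳ (s * a) ⟩
    s * a                           ∎
    where
    s a b : Carrier
    s = sgn k
    a = ι (n C k)
    b = ι (n C suc k)

  transform : (ℕ → Carrier) → ℕ → Carrier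
  transform f n = Σ≤ n (λ k → sgn k * ι (n C k) * f k)

  shiftedTransform : (ℕ → Carrier) → ℕ → Carrier
  shiftedTransform f n = Σ≤ n (λ k → sgn k * ι (suc n C suc k) * f k)

  Σ≤-transform : ∀ f n → Σ≤ n (transform f) ≈ shiftedTransform f n
  Σ≤-transform f zero    = refl
  Σ≤-transform f (suc n) = begin
    Σ≤ n (transform f) + transform f (suc n)
      ≈⟨ +-congʳ (Σ≤-transform f n) ⟩
    shiftedTransform f n + transform f (suc n)
      ≈⟨ +-comm _ _ ⟩
    transform f (suc n) + shiftedTransform f n
      ≈⟨ +-congˡ (+-identityʳ _) ⟨
    transform f (suc n) + (shiftedTransform f n + 0#)
      ≈⟨ +-congˡ (+-congˡ (k>n⇒w*nCk*x≈0 (sgn (suc n)) (f (suc n)) (ℕₚ.n<1+n (suc n)))) ⟨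
    transform f (suc n) + Σ≤ (suc n) (λ k → sgn k * ι (suc n C suc k) * f k)
      ≈⟨ Σ≤-distrib-+ (suc n) _ _ ⟨
    Σ≤ (suc n) (λ k → sgn k * ι (suc n C k) * f k + sgn k * ι (suc n C suc k) * f k)
      ≈⟨ Σ≤-cong (suc n) split ⟨
    shiftedTransform f (suc n) ∎
    where
    split : ∀ k → sgn k * ι (suc (suc n) C suc k) * f k
                  ≈ sgn k * ι (suc n C k) * f k + sgn k * ι (suc n C suc k) * f k
    split k = trans (*-congʳ (trans (*-congˡ (ι-pascal (suc n) k)) (distribˡ _ _ _))) (distribʳ _ _ _)

  shiftedTransform-Σ≤ : ∀ s n → shiftedTransform (λ k → Σ≤ k s) n ≈ transform s n
  shiftedTransform-Σ≤ s n = sym (begin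
    transform s n
      ≈⟨ Σ≤-by-parts {c = λ k → sgn k * ι (suc n C suc k)} {d = λ k → sgn k * ι (n C k)}
                     (sgn*C-pascal n) s n ⟩
    shiftedTransform (λ k → Σ≤ k s) n + sgn (suc n) * ι (n C suc n) * Σ≤ n s
      ≈⟨ +-congˡ (k>n⇒w*nCk*x≈0 (sgn (suc n)) (Σ≤ n s) (ℕₚ.n<1+n n)) ⟩
    shiftedTransform (λ k → Σ≤ k s) n + 0#
      ≈⟨ +-identityʳ _ ⟩
    shiftedTransform (λ k → Σ≤ k s) n ∎)

  cross-multiply : ∀ {a a⁻¹ b b⁻¹ x y} → a * a⁻¹ ≈ 1# → b * b⁻¹ ≈ 1# →
                   a * x ≈ b * y → x * b⁻¹ ≈ y * a⁻¹
  cross-multiply {a} {a⁻¹} {b} {b⁻¹} {x} {y} aa⁻¹≈1 bb⁻¹≈1 ax≈by = begin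
    x * b⁻¹                   ≈⟨ *-identityˡ _ ⟨
    1# * (x * b⁻¹)            ≈⟨ *-congʳ aa⁻¹≈1 ⟨
    (a * a⁻¹) * (x * b⁻¹)     ≈⟨ solve 4 (λ a a⁻¹ x b⁻¹ → (a ⊕ a⁻¹) ⊕ (x ⊕ b⁻¹) ⊜ (a ⊕ x) ⊕ (a⁻¹ ⊕ b⁻¹))
                                      refl a a⁻¹ x b⁻¹ ⟩
    (a * x) * (a⁻¹ * b⁻¹)     ≈⟨ *-congʳ ax≈by ⟩
    (b * y) * (a⁻¹ * b⁻¹)     ≈⟨ solve 4 (λ b y a⁻¹ b⁻¹ → (b ⊕ y) ⊕ (a⁻¹ ⊕ b⁻¹) ⊜ (b ⊕ b⁻¹) ⊕ (y ⊕ a⁻¹))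
                                      refl b y a⁻¹ b⁻¹ ⟩
    (b * b⁻¹) * (y * a⁻¹)     ≈⟨ *-congʳ bb⁻¹≈1 ⟩
    1# * (y * a⁻¹)            ≈⟨ *-identityˡ _ ⟩
    y * a⁻¹                   ∎

  module _ {inv : ℕ → Carrier} (inverts : InvertsPositives inv) where

    ι-C-absorption : ∀ n k → ι (n C k) * inv k ≈ ι (suc n C suc k) * inv n
    ι-C-absorption n k = cross-multiply (inverts n) (inverts k) (begin
      ι (suc n) * ι (n C k)            ≈⟨ ι-* (suc n) (n C k) ⟨
      ι (suc n ℕ.* (n C k))            ≡⟨ ≡.cong ι ([k+1]*[n+1]C[k+1]≡[n+1]*nCk n k) ⟨
      ι (suc k ℕ.* (suc n C suc k))    ≈⟨ ι-* (suc k) (suc n C suc k) ⟩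
      ι (suc k) * ι (suc n C suc k)    ∎)

    transform-absorption : ∀ f n → transform (λ k → inv k * f k) n ≈ inv n * shiftedTransform f n
    transform-absorption f n = trans (Σ≤-cong n absorb) (sym (*-distribˡ-Σ≤ n (inv n) _))
      where
      absorb : ∀ k → sgn k * ι (n C k) * (inv k * f k) ≈ inv n * (sgn k * ι (suc n C suc k) * f k)
      absorb k = begin
        sgn k * ι (n C k) * (inv k * f k)
          ≈⟨ solve 4 (λ s a i x → (s ⊕ a) ⊕ (i ⊕ x) ⊜ (s ⊕ (a ⊕ i)) ⊕ x) refl (sgn k) _ _ _ ⟩
        sgn k * (ι (n C k) * inv k) * f k
          ≈⟨ *-congʳ (*-congˡ (ι-C-absorption n k)) ⟩
        sgn k * (ι (suc n C suc k) * inv n) * f k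
          ≈⟨ solve 4 (λ s b j x → (s ⊕ (b ⊕ j)) ⊕ x ⊜ j ⊕ ((s ⊕ b) ⊕ x)) refl (sgn k) _ _ _ ⟩
        inv n * (sgn k * ι (suc n C suc k) * f k) ∎

theorem19 : ∀ {c ℓ : Level} (R : CommutativeRing c ℓ) →
    let open CommutativeRing R using (Carrier) in
    let open Binomial R in
    (inv : ℕ → Carrier) → InvertsPositives inv →
    (t τ : ℕ → Carrier) → BinomialPair t τ →
    BinomialPair (aSeq inv t) (αSeq inv τ)
theorem19 R inv inverts t τ pair n = sym (begin
  transform (aSeq inv t) n
    ≈⟨ transform-absorption inverts (λ k → Σ≤ k s) n ⟩
  inv n * shiftedTransform (λ k → Σ≤ k s) n
    ≈⟨ *-congˡ (shiftedTransform-Σ≤ s n) ⟩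
  inv n * transform s n
    ≈⟨ *-congˡ (Σ≤-cong n (λ k → *-congˡ (*-comm (t k) (inv k)))) ⟩
  inv n * transform (λ k → inv k * t k) n
    ≈⟨ *-congˡ (transform-absorption inverts t n) ⟩
  inv n * (inv n * shiftedTransform t n)
    ≈⟨ *-congˡ (*-congˡ (Σ≤-transform t n)) ⟨
  inv n * (inv n * Σ≤ n (transform t))
    ≈⟨ *-congˡ (*-congˡ (Σ≤-cong n pair)) ⟨
  inv n * (inv n * Σ≤ n τ)
    ≈⟨ *-assoc _ _ _ ⟨
  αSeq inv τ n ∎)
  where
  open CommutativeRing R
  open Binomial R
  open BinomialTransform R
  open SetoidReasoning setoid
  s : ℕ → Carrier
  s j = t j * inv j
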